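{- Let $T,k$ be positive integers and $w=\lceil T/k\rceil$. Consider a system of time-bucketed balance record structures (as defined in the context), all initially empty, to which an arbitrary finite sequence of operations (Deposit, Consume, Transfer, Prune, with arbitrary positive amounts and arbitrary sender/recipient choices, including arbitrarily many deposits by an adversary into a victim's structure) is applied at nondecreasing integer times. Then there is a constant $C$, independent of $k$, $T$ and of the sequence of operations, such that every single operation on any structure performs at most $C(k+1)^2$ elementary steps (record reads, writes, comparisons and shifts); in particular Insert, Consume and Prune each perform $O(k)$ steps and Transfer performs $O(k^2)$ steps, independently of the number of previous deposits.
   Context: Times are nonnegative integers. A balance record structure is a finite list $\mathcal{B}=[(a_1,e_1),\dots,(a_n,e_n)]$ of pairs (amount $a_i\ge 0$, expiration timestamp $e_i$), kept sorted with $e_1<e_2<\dots<e_n$. Fix a TTL $T$ and bucket width $w=\lceil T/k\rceil$, and define $\mathrm{BucketedExpiry}(t)=\lceil (t+T)/w\rceil\cdot w$. The operations, performed at current time $t_{\mathrm{now}}$, are: - Prune$(\mathcal{B},t_{\mathrm{now}})$: a single pass deleting every record with $e_i\le t_{\mathrm{now}}$ or $a_i=0$, keeping the order of the remaining ones. - Insert$(\mathcal{B},a,e,t_{\mathrm{now}})$: first run Prune$(\mathcal{B},t_{\mathrm{now}})$; then scan records in order: if a record with $e_i=e$ is found, set $a_i\leftarrow a_i+a$ and stop; if a record with $e_i>e$ is found first, insert $(a,e)$ immediately before it (shifting later records) and stop; if neither occurs, append $(a,e)$ at the end. - Deposit of amount $a>0$ at time $t$: Insert$(\mathcal{B},a,\mathrm{BucketedExpiry}(t),t)$.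 - Consume$(\mathcal{B},a,t_{\mathrm{now}})$: with remaining $r=a$ and an empty list $C$, scan records in order, skipping those with $e_i\le t_{\mathrm{now}}$; for each other record put $\delta=\min(r,a_i)$, set $a_i\leftarrow a_i-\delta$, append $(\delta,e_i)$ to $C$, and $r\leftarrow r-\delta$; if $r=0$ return success and $C$. If the scan ends with $r>0$, return failure. - Transfer of amount $a$ from $\mathcal{B}_s$ to $\mathcal{B}_r$ at time $t_{\mathrm{now}}$: run Consume$(\mathcal{B}_s,a,t_{\mathrm{now}})$; if it fails, stop; otherwise for each $(a_i,e_i)\in C$ run Insert$(\mathcal{B}_r,a_i,e_i,t_{\mathrm{now}})$ (keeping the original expiration $e_i$). -}

module Defs where

open import Data.Nat using (ℕ; zero; suc; _+_; _*_; _∸_; _⊓_; _≤_; _<_; _^_; _≤ᵇ_; _≡ᵇ_; _<ᵇ_)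
open import Data.Nat.DivMod using (_/_)
open import Data.Unit using (⊤)
open import Data.Bool using (Bool; true; false; if_then_else_; _∨_)
open import Data.Product using (_×_; _,_; proj₁; proj₂)
open import Data.Maybe using (Maybe; just; nothing)
open import Data.List using (List; []; _∷_; length; map)
open import Data.List.Relation.Unary.All using (All)
open import Data.List.Relation.Unary.Linked using (Linked)

-- ceiling division ⌈ m / n ⌉ ; the value for n = 0 is an irrelevant
-- default (never used under the hypotheses T > 0, k > 0).
ceilDiv : ℕ → ℕ → ℕ
ceilDiv m zero    = 0
ceilDiv m (suc n) = (m + n) / suc n

bucketWidth : (T k : ℕ) → ℕ
bucketWidth T k = ceilDiv T k

bucketedExpiry : (T k t : ℕ) → ℕ
bucketedExpiry T k t = ceilDiv (t + T) (bucketWidth T k) * bucketWidth T k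

-- a record (amount , expiration timestamp)
Record : Set
Record = ℕ × ℕ

-- a balance record structure: list of records (kept sorted by expiry)
Balance : Set
Balance = List Record

-- All operations below are instrumented: they return their result
-- together with the number of elementary steps performed (each record
-- read/compare/write/shift counts one step, plus one step of overhead).

prune : ℕ → Balance → Balance
prune t [] = []
prune t ((a , e) ∷ rs) =
  if (e ≤ᵇ t) ∨ (a ≡ᵇ 0) then prune t rs else (a , e) ∷ prune t rs

pruneCost : ℕ → Balance → ℕ
pruneCost t B = suc (length B)

insertScan : ℕ → ℕ → Balance → Balance × ℕ
insertScan a e [] = ((a , e) ∷ []) , 1
insertScan a e ((aᵢ , eᵢ) ∷ rs) =
  if eᵢ ≡ᵇ e then (((aᵢ + a , eᵢ) ∷ rs) , 1)
  else if e <ᵇ eᵢ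
    then (((a , e) ∷ (aᵢ , eᵢ) ∷ rs) , suc (suc (length rs))) -- insert, shifting later records
    else (let r = insertScan a e rs in ((aᵢ , eᵢ) ∷ proj₁ r) , suc (proj₂ r))

insert : ℕ → ℕ → ℕ → Balance → Balance × ℕ
insert a e t B =
  let r = insertScan a e (prune t B) in proj₁ r , pruneCost t B + proj₂ r

-- Consume scan with remaining amount r.  Success: the new structure and
-- the list C of (δ , eᵢ).  Failure: nothing.
consumeScan : ℕ → ℕ → Balance → Maybe (Balance × List Record) × ℕ
consumeScan r t [] = nothing , 1
consumeScan r t ((aᵢ , eᵢ) ∷ rs) =
  if eᵢ ≤ᵇ t
    then (let x = consumeScan r t rs in
          consPrefix (aᵢ , eᵢ) nothing (proj₁ x) , suc (proj₂ x))
    else (let δ = r ⊓ aᵢ in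
          if (r ∸ δ) ≡ᵇ 0
            then (just (((aᵢ ∸ δ , eᵢ) ∷ rs) , ((δ , eᵢ) ∷ [])) , 1)
            else (let x = consumeScan (r ∸ δ) t rs in
                  consPrefix (aᵢ ∸ δ , eᵢ) (just (δ , eᵢ)) (proj₁ x) , suc (proj₂ x)))
  where
  consPrefix : Record → Maybe Record → Maybe (Balance × List Record) → Maybe (Balance × List Record)
  consPrefix x c nothing = nothing
  consPrefix x nothing  (just (B , C)) = just (x ∷ B , C)
  consPrefix x (just c) (just (B , C)) = just (x ∷ B , c ∷ C)

consume : ℕ → ℕ → Balance → Maybe (Balance × List Record) × ℕ
consume a t B = consumeScan a t B

State : Set
State = ℕ → Balance

emptyState : State
emptyState _ = []

update : State → ℕ → Balance → State
update σ i B j = if j ≡ᵇ i then B else σ j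

data Op : Set where
  deposit  : (acct amount : ℕ) → Op
  consumeOp : (acct amount : ℕ) → Op
  transfer : (sender recipient amount : ℕ) → Op
  pruneOp  : (acct : ℕ) → Op

PositiveAmount : Op → Set
PositiveAmount (deposit _ a)    = 0 < a
PositiveAmount (consumeOp _ a)  = 0 < a
PositiveAmount (transfer _ _ a) = 0 < a
PositiveAmount (pruneOp _)      = ⊤

insertAll : ℕ → ℕ → List Record → State → State × ℕ
insertAll r t [] σ = σ , 0
insertAll r t ((a , e) ∷ C) σ =
  let x = insert a e t (σ r)
      y = insertAll r t C (update σ r (proj₁ x))
  in proj₁ y , proj₂ x + proj₂ y

step : (T k t : ℕ) → Op → State → State × ℕ
step T k t (deposit i a) σ =
  let x = insert a (bucketedExpiry T k t) t (σ i) in update σ i (proj₁ x) , proj₂ x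
step T k t (consumeOp i a) σ with consume a t (σ i)
... | nothing , c = σ , c
... | just (B , _) , c = update σ i B , c
step T k t (transfer s r a) σ with consume a t (σ s)
... | nothing , c = σ , c
... | just (B , C) , c =
  let y = insertAll r t C (update σ s B) in proj₁ y , c + proj₂ y
step T k t (pruneOp i) σ =
  update σ i (prune t (σ i)) , pruneCost t (σ i)

run : (T k : ℕ) → State → List (ℕ × Op) → List (Op × ℕ)
run T k σ [] = []
run T k σ ((t , o) ∷ ops) =
  let x = step T k t o σ in (o , proj₂ x) ∷ run T k (proj₁ x) ops

NondecreasingTimes : List (ℕ × Op) → Set
NondecreasingTimes ops = Linked _≤_ (map proj₁ ops)

PositiveAmounts : List (ℕ × Op) → Set
PositiveAmounts ops = All (λ p → PositiveAmount (proj₂ p)) ops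

-- "in particular" per-operation bound: O(k) for Deposit (= Insert),
-- Consume and Prune, O(k²) for Transfer
opBound : ℕ → ℕ → Op → ℕ
opBound C k (transfer _ _ _) = C * (suc k) ^ 2
opBound C k _                = C * suc k

-- Every expiration timestamp ever written is a multiple of the bucket width w and
-- lies at most T + w after the time of the write; consumption and transfer only
-- reuse timestamps already present.  After the pruning that opens every Insert,
-- a structure therefore holds strictly increasing multiples of w in
-- (t, t + T + w], and there are at most (T + w) / w ≤ k + 1 of those.  So every
-- structure has at most k + 2 records at all times, Prune, Insert and Consume
-- scan O(k) records, and a Transfer performs at most k + 2 Inserts.
module Submission where

open import Defs
open import Data.Bool using (true; false; _∨_)
open import Data.List using (List; []; _∷_; length; map)
open import Data.List.Properties using (length-map)
open import Data.List.Relation.Unary.All as All using (All; []; _∷_)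
open import Data.List.Relation.Unary.AllPairs using (AllPairs; []; _∷_)
open import Data.List.Relation.Unary.Linked using (Linked; []; [-]; _∷_)
open import Data.List.Relation.Binary.Sublist.Propositional
  using (_⊆_; []; _∷_; _∷ʳ_; minimum; ⊆-reflexive)
open import Data.List.Relation.Binary.Sublist.Propositional.Properties
  using (All-resp-⊆; length-mono-≤; map⁺)
open import Data.Maybe using (Maybe; just; nothing)
open import Data.Nat using (ℕ; suc; _+_; _*_; _∸_; _⊓_; _^_; _≤_; _<_; z≤n; s≤s; s≤s⁻¹; _≤ᵇ_; _≡ᵇ_; _<ᵇ_)
open import Data.Nat.Properties
open import Data.Nat.DivMod using (_/_; _%_; m≡m%n+[m/n]*n; m%n<n; m/n*n≤m)
open import Data.Nat.Divisibility using (_∣_; divides)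
open import Data.Nat.Tactic.RingSolver using (solve-∀)
open import Data.Product using (Σ; _×_; _,_; proj₁; proj₂)
open import Data.Unit using (⊤; tt)
open import Relation.Binary.PropositionalEquality using (_≡_; refl; cong; subst; subst₂)
open import Relation.Nullary.Reflects using (Reflects; ofʸ; ofⁿ; fromEquivalence)

≡ᵇ-reflects-≡ : ∀ m n → Reflects (m ≡ n) (m ≡ᵇ n)
≡ᵇ-reflects-≡ m n = fromEquivalence (≡ᵇ⇒≡ m n) (≡⇒≡ᵇ m n)

≤-by-slack : ∀ {m n} d → m + d ≡ n → m ≤ n
≤-by-slack {m} d eq = subst (m ≤_) eq (m≤m+n m d)

ceilDiv*n≤m+n : ∀ m n → 0 < n → ceilDiv m n * n ≤ m + n
ceilDiv*n≤m+n m (suc n) _ = ≤-trans (m/n*n≤m (m + n) (suc n)) (+-monoʳ-≤ m (n≤1+n n))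

m≤ceilDiv*n : ∀ m n → 0 < n → m ≤ ceilDiv m n * n
m≤ceilDiv*n m (suc n) _ = +-cancelʳ-≤ n m _ (begin
  m + n                       ≡⟨ m≡m%n+[m/n]*n (m + n) (suc n) ⟩
  (m + n) % suc n + q * suc n ≤⟨ +-monoˡ-≤ (q * suc n) (s≤s⁻¹ (m%n<n (m + n) (suc n))) ⟩
  n + q * suc n               ≡⟨ +-comm n (q * suc n) ⟩
  q * suc n + n               ∎)
  where
  open ≤-Reasoning
  q = (m + n) / suc n

ceilDiv-pos : ∀ m n → 0 < m → 0 < n → 0 < ceilDiv m n
ceilDiv-pos m n m>0 n>0 = n≢0⇒n>0 λ q≡0 →
  <⇒≱ m>0 (subst (λ q → m ≤ q * n) q≡0 (m≤ceilDiv*n m n n>0))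

AllPairs-resp-⊆ : ∀ {R : ℕ → ℕ → Set} {xs ys} → xs ⊆ ys → AllPairs R ys → AllPairs R xs
AllPairs-resp-⊆ []           []         = []
AllPairs-resp-⊆ (_ ∷ʳ xs⊆)   (_ ∷ rys)  = AllPairs-resp-⊆ xs⊆ rys
AllPairs-resp-⊆ (refl ∷ xs⊆) (ry ∷ rys) = All-resp-⊆ xs⊆ ry ∷ AllPairs-resp-⊆ xs⊆ rys

∣-<⇒+≤ : ∀ {w x y} → w ∣ x → w ∣ y → x < y → x + w ≤ y
∣-<⇒+≤ {w} (divides p refl) (divides q refl) p*w<q*w =
  subst (_≤ q * w) (+-comm w (p * w)) (*-monoˡ-≤ w (*-cancelʳ-< w p q p*w<q*w))

-- Consecutive elements are at least w apart, so each element uses up w of the window [m, hi + w].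
multiples-count : ∀ {w m hi} xs → m ≤ hi + w → All (λ x → w ∣ x × x ≤ hi) xs →
                  All (m ≤_) xs → AllPairs _<_ xs → length xs * w + m ≤ hi + w
multiples-count [] m≤ _ _ _ = m≤
multiples-count {w} {m} {hi} (x ∷ xs) _ ((w∣x , x≤hi) ∷ bs) (m≤x ∷ _) (x<xs ∷ inc) = begin
  (w + length xs * w) + m ≤⟨ +-monoʳ-≤ (w + length xs * w) m≤x ⟩
  (w + length xs * w) + x ≡⟨ shuffle w (length xs * w) x ⟩
  length xs * w + (x + w) ≤⟨ multiples-count xs (+-monoˡ-≤ w x≤hi) bs x+w≤xs inc ⟩
  hi + w                  ∎
  where
  open ≤-Reasoning
  shuffle : ∀ a b c → (a + b) + c ≡ b + (c + a)
  shuffle = solve-∀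
  x+w≤xs : All (x + w ≤_) xs
  x+w≤xs = All.zipWith (λ { ((w∣y , _) , x<y) → ∣-<⇒+≤ w∣x w∣y x<y }) (bs , x<xs)

expiries : Balance → List ℕ
expiries = map proj₂

length-expiries : ∀ B → length (expiries B) ≡ length B
length-expiries = length-map proj₂

prune-⊆ : ∀ t B → prune t B ⊆ B
prune-⊆ t [] = []
prune-⊆ t ((a , e) ∷ B) with (e ≤ᵇ t) ∨ (a ≡ᵇ 0)
... | true  = (a , e) ∷ʳ prune-⊆ t B
... | false = refl ∷ prune-⊆ t B

prune-live : ∀ t B → All (t <_) (expiries (prune t B))
prune-live t [] = []
prune-live t ((a , e) ∷ B) with e ≤ᵇ t | ≤ᵇ-reflects-≤ e t
... | true  | _         = prune-live t B
... | false | ofⁿ e≰t with a ≡ᵇ 0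
...   | true  = prune-live t B
...   | false = ≰⇒> e≰t ∷ prune-live t B

insertScan-cost : ∀ a e B → proj₂ (insertScan a e B) ≤ suc (length B)
insertScan-cost a e [] = ≤-refl
insertScan-cost a e ((aᵢ , eᵢ) ∷ B) with eᵢ ≡ᵇ e
... | true = s≤s z≤n
... | false with e <ᵇ eᵢ
...   | true  = ≤-refl
...   | false = s≤s (insertScan-cost a e B)

insertScan-length : ∀ a e B → length (proj₁ (insertScan a e B)) ≤ suc (length B)
insertScan-length a e [] = ≤-refl
insertScan-length a e ((aᵢ , eᵢ) ∷ B) with eᵢ ≡ᵇ e
... | true = n≤1+n _
... | false with e <ᵇ eᵢ
...   | true  = ≤-refl
...   | false = s≤s (insertScan-length a e B)

insertScan-All : ∀ {P : ℕ → Set} a e B → P e → All P (expiries B) →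
                 All P (expiries (proj₁ (insertScan a e B)))
insertScan-All a e [] pe [] = pe ∷ []
insertScan-All a e ((aᵢ , eᵢ) ∷ B) pe (peᵢ ∷ pB) with eᵢ ≡ᵇ e
... | true = peᵢ ∷ pB
... | false with e <ᵇ eᵢ
...   | true  = pe ∷ peᵢ ∷ pB
...   | false = peᵢ ∷ insertScan-All a e B pe pB

insertScan-increasing : ∀ a e B → AllPairs _<_ (expiries B) →
                        AllPairs _<_ (expiries (proj₁ (insertScan a e B)))
insertScan-increasing a e [] [] = [] ∷ []
insertScan-increasing a e ((aᵢ , eᵢ) ∷ B) (eᵢ<B ∷ inc)
  with eᵢ ≡ᵇ e | ≡ᵇ-reflects-≡ eᵢ e
... | true  | _ = eᵢ<B ∷ inc
... | false | ofⁿ eᵢ≢e with e <ᵇ eᵢ | <ᵇ-reflects-< e eᵢ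
...   | true  | ofʸ e<eᵢ = (e<eᵢ ∷ All.map (<-trans e<eᵢ) eᵢ<B) ∷ eᵢ<B ∷ inc
...   | false | ofⁿ e≮eᵢ =
        insertScan-All a e B (≤∧≢⇒< (≮⇒≥ e≮eᵢ) eᵢ≢e) eᵢ<B ∷ insertScan-increasing a e B inc

insert-cost-length : ∀ a e t B → proj₂ (insert a e t B) ≤ suc (length B) + suc (length B)
insert-cost-length a e t B = +-monoʳ-≤ (suc (length B))
  (≤-trans (insertScan-cost a e (prune t B)) (s≤s (length-mono-≤ (prune-⊆ t B))))

Consumed : Balance → Maybe (Balance × List Record) → Set
Consumed B nothing         = ⊤
Consumed B (just (B′ , C)) = expiries B′ ≡ expiries B × expiries C ⊆ expiries B

consumeScan-consumed : ∀ r t B → Consumed B (proj₁ (consumeScan r t B))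
consumeScan-consumed r t [] = tt
consumeScan-consumed r t ((aᵢ , eᵢ) ∷ B) with eᵢ ≤ᵇ t
... | true with consumeScan r t B | consumeScan-consumed r t B
...   | nothing , _        | _          = tt
...   | just (B′ , C) , _  | (eq , C⊆) = cong (eᵢ ∷_) eq , eᵢ ∷ʳ C⊆
consumeScan-consumed r t ((aᵢ , eᵢ) ∷ B) | false with (r ∸ (r ⊓ aᵢ)) ≡ᵇ 0
... | true = refl , refl ∷ minimum _
... | false with consumeScan (r ∸ (r ⊓ aᵢ)) t B | consumeScan-consumed (r ∸ (r ⊓ aᵢ)) t B
...   | nothing , _       | _          = tt
...   | just (B′ , C) , _ | (eq , C⊆) = cong (eᵢ ∷_) eq , refl ∷ C⊆

consumeScan-cost : ∀ r t B → proj₂ (consumeScan r t B) ≤ suc (length B)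
consumeScan-cost r t [] = ≤-refl
consumeScan-cost r t ((aᵢ , eᵢ) ∷ B) with eᵢ ≤ᵇ t
... | true = s≤s (consumeScan-cost r t B)
... | false with (r ∸ (r ⊓ aᵢ)) ≡ᵇ 0
...   | true  = s≤s z≤n
...   | false = s≤s (consumeScan-cost (r ∸ (r ⊓ aᵢ)) t B)

insert-bound : ∀ k → (3 + k) + (3 + k) ≤ 15 * suc k
insert-bound k = ≤-by-slack (13 * k + 9) (identity k)
  where
  identity : ∀ k → (3 + k) + (3 + k) + (13 * k + 9) ≡ 15 * suc k
  identity = solve-∀

scan-bound : ∀ k → 3 + k ≤ 15 * suc k
scan-bound k = ≤-trans (m≤m+n (3 + k) (3 + k)) (insert-bound k)

transfer-bound : ∀ k → (3 + k) + (2 + k) * ((3 + k) + (3 + k)) ≤ 15 * suc k ^ 2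
transfer-bound k = ≤-by-slack (13 * k * k + 19 * k) (identity k)
  where
  -- suc k ^ 2 is unfolded because solve-∀ rejects _^_
  identity : ∀ k → (3 + k) + (2 + k) * ((3 + k) + (3 + k)) + (13 * k * k + 19 * k) ≡ 15 * (suc k * (suc k * 1))
  identity = solve-∀

opBound-≤ : ∀ k o → opBound 15 k o ≤ 15 * suc k ^ 2
opBound-≤ k (transfer _ _ _) = ≤-refl
opBound-≤ k (deposit _ _)    = *-monoʳ-≤ 15 (m≤m*n (suc k) (suc k ^ 1))
opBound-≤ k (consumeOp _ _)  = *-monoʳ-≤ 15 (m≤m*n (suc k) (suc k ^ 1))
opBound-≤ k (pruneOp _)      = *-monoʳ-≤ 15 (m≤m*n (suc k) (suc k ^ 1))

module Invariant {T k : ℕ} (T>0 : 0 < T) (k>0 : 0 < k) where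

  w : ℕ
  w = bucketWidth T k

  w>0 : 0 < w
  w>0 = ceilDiv-pos T k T>0 k>0

  T≤k*w : T ≤ k * w
  T≤k*w = subst (T ≤_) (*-comm w k) (m≤ceilDiv*n T k k>0)

  Bucketed : ℕ → ℕ → Set
  Bucketed t e = w ∣ e × e ≤ t + T + w

  bucketedExpiry-bucketed : ∀ t → Bucketed t (bucketedExpiry T k t)
  bucketedExpiry-bucketed t = divides (ceilDiv (t + T) w) refl , ceilDiv*n≤m+n (t + T) w w>0

  record WellFormed (t : ℕ) (B : Balance) : Set where
    field
      increasing : AllPairs _<_ (expiries B)
      bucketed   : All (Bucketed t) (expiries B)
      bounded    : length B ≤ 2 + k
  open WellFormed

  wellFormed-mono : ∀ {t t′} B → t ≤ t′ → WellFormed t B → WellFormed t′ B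
  wellFormed-mono B t≤t′ wf = record
    { increasing = increasing wf
    ; bucketed   = All.map (λ (w∣e , e≤) → w∣e , ≤-trans e≤ (+-monoˡ-≤ w (+-monoˡ-≤ T t≤t′)))
                           (bucketed wf)
    ; bounded    = bounded wf
    }

  wellFormed-⊆ : ∀ {t} B B′ → expiries B′ ⊆ expiries B → WellFormed t B → WellFormed t B′
  wellFormed-⊆ B B′ B′⊆B wf = record
    { increasing = AllPairs-resp-⊆ B′⊆B (increasing wf)
    ; bucketed   = All-resp-⊆ B′⊆B (bucketed wf)
    ; bounded    = ≤-trans (subst₂ _≤_ (length-expiries B′) (length-expiries B) (length-mono-≤ B′⊆B))
                           (bounded wf)
    }

  prune-length : ∀ t B → WellFormed t B → length (prune t B) ≤ suc k
  prune-length t B wf = s≤s⁻¹ (*-cancelʳ-< w n (2 + k) (+-cancelʳ-≤ t _ _ (begin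
      suc (n * w) + t     ≡⟨ +-suc (n * w) t ⟨
      n * w + suc t       ≤⟨ counted ⟩
      t + T + w + w       ≤⟨ +-monoˡ-≤ w (+-monoˡ-≤ w (+-monoʳ-≤ t T≤k*w)) ⟩
      t + k * w + w + w   ≡⟨ rearrange t k w ⟩
      (2 + k) * w + t     ∎)))
    where
    open ≤-Reasoning
    P = prune t B
    n = length P
    wfP : WellFormed t P
    wfP = wellFormed-⊆ B P (map⁺ proj₂ (prune-⊆ t B)) wf
    t<t+T+w+w : t < t + T + w + w
    t<t+T+w+w = <-≤-trans (m<m+n t w>0) (≤-trans (+-monoˡ-≤ w (m≤m+n t T)) (m≤m+n (t + T + w) w))
    counted : n * w + suc t ≤ t + T + w + w
    counted = subst (λ m → m * w + suc t ≤ t + T + w + w) (length-expiries P)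
      (multiples-count (expiries P) t<t+T+w+w
        (bucketed wfP) (prune-live t B) (increasing wfP))
    rearrange : ∀ t k w → t + k * w + w + w ≡ (2 + k) * w + t
    rearrange = solve-∀

  prune-wellFormed : ∀ t B → WellFormed t B → WellFormed t (prune t B)
  prune-wellFormed t B = wellFormed-⊆ B (prune t B) (map⁺ proj₂ (prune-⊆ t B))

  insert-wellFormed : ∀ a e t B → Bucketed t e → WellFormed t B → WellFormed t (proj₁ (insert a e t B))
  insert-wellFormed a e t B be wf = record
    { increasing = insertScan-increasing a e P (increasing wfP)
    ; bucketed   = insertScan-All a e P be (bucketed wfP)
    ; bounded    = ≤-trans (insertScan-length a e P) (s≤s (prune-length t B wf))
    }
    where
    P = prune t B
    wfP = prune-wellFormed t B wf

  insert-cost-bounded : ∀ a e t B → WellFormed t B → proj₂ (insert a e t B) ≤ (3 + k) + (3 + k)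
  insert-cost-bounded a e t B wf = ≤-trans (insert-cost-length a e t B) (+-mono-≤ (s≤s (bounded wf)) (s≤s (bounded wf)))

  consume-cost-bounded : ∀ a t B → WellFormed t B → proj₂ (consume a t B) ≤ 3 + k
  consume-cost-bounded a t B wf = ≤-trans (consumeScan-cost a t B) (s≤s (bounded wf))

  AllWellFormed : ℕ → State → Set
  AllWellFormed t σ = ∀ i → WellFormed t (σ i)

  update-wellFormed : ∀ {t} σ i B → AllWellFormed t σ → WellFormed t B → AllWellFormed t (update σ i B)
  update-wellFormed σ i B wfσ wfB j with j ≡ᵇ i
  ... | true  = wfB
  ... | false = wfσ j

  insertAll-wellFormed : ∀ r t C σ → AllWellFormed t σ → All (Bucketed t) (expiries C) →
    AllWellFormed t (proj₁ (insertAll r t C σ)) × proj₂ (insertAll r t C σ) ≤ length C * ((3 + k) + (3 + k))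
  insertAll-wellFormed r t [] σ wfσ [] = wfσ , z≤n
  insertAll-wellFormed r t ((a , e) ∷ C) σ wfσ (be ∷ bC) =
    proj₁ rest , +-mono-≤ (insert-cost-bounded a e t (σ r) (wfσ r)) (proj₂ rest)
    where
    rest = insertAll-wellFormed r t C (update σ r (proj₁ (insert a e t (σ r))))
             (update-wellFormed σ r _ wfσ (insert-wellFormed a e t (σ r) be (wfσ r))) bC

  empty-wellFormed : ∀ {t} → WellFormed t []
  empty-wellFormed = record { increasing = [] ; bucketed = [] ; bounded = z≤n }

  step-wellFormed : ∀ t o σ → AllWellFormed t σ →
    AllWellFormed t (proj₁ (step T k t o σ)) × proj₂ (step T k t o σ) ≤ opBound 15 k o
  step-wellFormed t (deposit i a) σ wfσ =
    update-wellFormed σ i _ wfσ (insert-wellFormed a e t (σ i) (bucketedExpiry-bucketed t) (wfσ i)) ,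
    ≤-trans (insert-cost-bounded a e t (σ i) (wfσ i)) (insert-bound k)
    where e = bucketedExpiry T k t
  step-wellFormed t (consumeOp i a) σ wfσ
    with consume a t (σ i) | consumeScan-consumed a t (σ i) | consume-cost-bounded a t (σ i) (wfσ i)
  ... | nothing , _      | _        | c≤ = wfσ , ≤-trans c≤ (scan-bound k)
  ... | just (B , _) , _ | (eq , _) | c≤ =
    update-wellFormed σ i B wfσ (wellFormed-⊆ (σ i) B (⊆-reflexive eq) (wfσ i)) ,
    ≤-trans c≤ (scan-bound k)
  step-wellFormed t (transfer s r a) σ wfσ
    with consume a t (σ s) | consumeScan-consumed a t (σ s) | consume-cost-bounded a t (σ s) (wfσ s)
  ... | nothing , _      | _         | c≤ = wfσ , ≤-trans (≤-trans c≤ (m≤m+n (3 + k) _)) (transfer-bound k)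
  ... | just (B , C) , _ | (eq , C⊆) | c≤ =
    proj₁ inserted ,
    ≤-trans (+-mono-≤ c≤ (≤-trans (proj₂ inserted) (*-monoˡ-≤ ((3 + k) + (3 + k)) (bounded wfC))))
            (transfer-bound k)
    where
    wfC = wellFormed-⊆ (σ s) C C⊆ (wfσ s)
    inserted = insertAll-wellFormed r t C (update σ s B)
                 (update-wellFormed σ s B wfσ (wellFormed-⊆ (σ s) B (⊆-reflexive eq) (wfσ s)))
                 (bucketed wfC)
  step-wellFormed t (pruneOp i) σ wfσ =
    update-wellFormed σ i _ wfσ (prune-wellFormed t (σ i) (wfσ i)) ,
    ≤-trans (s≤s (bounded (wfσ i))) (scan-bound k)

  run-bounded : ∀ t σ ops → AllWellFormed t σ → Linked _≤_ (t ∷ map proj₁ ops) →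
    All (λ oc → proj₂ oc ≤ opBound 15 k (proj₁ oc)) (run T k σ ops)
  run-bounded t σ [] _ _ = []
  run-bounded t σ ((t′ , o) ∷ ops) wfσ (t≤t′ ∷ ordered) =
    proj₂ stepped ∷ run-bounded t′ (proj₁ (step T k t′ o σ)) ops (proj₁ stepped) ordered
    where
    stepped = step-wellFormed t′ o σ (λ i → wellFormed-mono (σ i) t≤t′ (wfσ i))

0∷-linked : ∀ {ts} → Linked _≤_ ts → Linked _≤_ (0 ∷ ts)
0∷-linked []             = [-]
0∷-linked [-]            = z≤n ∷ [-]
0∷-linked (t≤ ∷ ordered) = z≤n ∷ t≤ ∷ ordered

theorem3 : Σ ℕ λ C → (T k : ℕ) → 0 < T → 0 < k →
    (ops : List (ℕ × Op)) → NondecreasingTimes ops → PositiveAmounts ops →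
    All (λ oc → (proj₂ oc ≤ C * (suc k) ^ 2) × (proj₂ oc ≤ opBound C k (proj₁ oc)))
        (run T k emptyState ops)
theorem3 = 15 , λ T k T>0 k>0 ops ordered _ →
  All.map (λ {oc} c≤ → ≤-trans c≤ (opBound-≤ k (proj₁ oc)) , c≤)
    (run-bounded T>0 k>0 0 emptyState ops (λ _ → empty-wellFormed T>0 k>0) (0∷-linked ordered))
  where open Invariant using (run-bounded; empty-wellFormed)
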